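{- Let $n$ be a positive even integer. Then $(1,n^{(n+1)k},n^{(n+1)k}+1)$ is an $abc$ triple for each positive odd integer $k$.
   Context: For a positive integer $n$, $\operatorname{rad}(n)$ denotes the product of the distinct prime factors of $n$. An $abc$ triple is a triple $(a,b,c)$ of relatively prime positive integers with $a+b=c$ and $\operatorname{rad}(abc)<c$. -}

module Defs where

open import Data.Nat using (ℕ; zero; suc; _+_; _*_; _<_)
open import Data.Nat.Divisibility using (_∣_; _∣?_)
open import Data.Nat.Primality using (Prime; prime?)
open import Data.Nat.Coprimality using (Coprime)
open import Data.Product using (_×_)
open import Relation.Binary.PropositionalEquality using (_≡_)
open import Relation.Nullary using (yes; no)
open import Relation.Nullary.Decidable using (_×-dec_)

radUpTo : ℕ → ℕ → ℕ
radUpTo zero    n = 1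
radUpTo (suc m) n with prime? (suc m) ×-dec (suc m ∣? n)
... | yes _ = suc m * radUpTo m n
... | no  _ = radUpTo m n

-- rad n : product of the distinct prime divisors of n (rad 1 = 1).
-- (For n = 0 this gives 1; it is only ever applied to positive integers.)
rad : ℕ → ℕ
rad n = radUpTo n n

IsAbcTriple : ℕ → ℕ → ℕ → Set
IsAbcTriple a b c =
  (0 < a × 0 < b × 0 < c) ×
  (Coprime a b × Coprime a c × Coprime b c) ×
  (a + b ≡ c) ×
  (rad (a * b * c) < c)

-- Since n ≡ -1 modulo n + 1, for odd e the binomial expansion gives
-- n ^ e + 1 ≡ e (n + 1) modulo (n + 1)².  With e = (n + 1) k this makes
-- (n + 1)² divide n ^ e + 1, so rad (n ^ e (n ^ e + 1)) divides
-- n (n ^ e + 1) / (n + 1), which is smaller than n ^ e + 1.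
module Submission where

open import Defs
open import Data.Nat using (ℕ; suc; _+_; _*_; _^_; _<_)
open import Data.Nat.Divisibility using (_∣_)
open import Relation.Nullary using (¬_)

open import Data.Nat using (zero; z≤n; s≤s; NonZero; >-nonZero; nonTrivial⇒n>1)
open import Data.Nat.Properties
open import Data.Nat.Divisibility
  using (divides; _∣?_; ∣⇒≤; ∣m⇒∣m*n; ∣n⇒∣m*n; ∣1⇒≡1; ∣m+n∣m⇒∣n; 1∣_; ∣-refl)
open import Data.Nat.DivMod using (_%_; _/_; m≡m%n+[m/n]*n; m%n<n)
open import Data.Nat.Coprimality using (Coprime; 1-coprimeTo)
open import Data.Nat.Primality using (Prime; prime?; prime[2]; euclidsLemma; prime⇒nonTrivial)
import Data.Integer as ℤ
open ℤ using (+_; 1ℤ)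
open import Data.Integer.Properties using (pos-*; pos-+; abs-*)
import Data.Integer.Divisibility.Signed as ℤ∣
open import Data.Integer.Solver using (module +-*-Solver)
open import Data.Product using (_,_)
open import Data.Sum using (inj₁; inj₂)
open import Data.Empty using (⊥-elim)
open import Relation.Nullary using (yes; no)
open import Relation.Nullary.Decidable using (_×-dec_)
open import Relation.Binary.PropositionalEquality
open ≡-Reasoning

prime∤1 : ∀ {p} → Prime p → ¬ p ∣ 1
prime∤1 {p} pp p∣1 = <⇒≢ (nonTrivial⇒n>1 p {{prime⇒nonTrivial pp}}) (sym (∣1⇒≡1 p∣1))

prime∣^⇒∣ : ∀ {p} m e → Prime p → p ∣ m ^ e → p ∣ m
prime∣^⇒∣ m zero    pp p∣1 = ⊥-elim (prime∤1 pp p∣1)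
prime∣^⇒∣ m (suc e) pp p∣m^[1+e] with euclidsLemma m (m ^ e) pp p∣m^[1+e]
... | inj₁ p∣m   = p∣m
... | inj₂ p∣m^e = prime∣^⇒∣ m e pp p∣m^e

¬2∣⇒≡1+[m/2]*2 : ∀ {m} → ¬ 2 ∣ m → m ≡ 1 + m / 2 * 2
¬2∣⇒≡1+[m/2]*2 {m} 2∤m with m % 2 | m%n<n m 2 | m≡m%n+[m/n]*n m 2
... | 0 | _               | m≡[m/2]*2 = ⊥-elim (2∤m (divides (m / 2) m≡[m/2]*2))
... | 1 | _               | m≡1+[m/2]*2 = m≡1+[m/2]*2
... | suc (suc _) | s≤s (s≤s ()) | _

2∣⇒¬2∣[m+1] : ∀ {m} → 2 ∣ m → ¬ 2 ∣ m + 1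
2∣⇒¬2∣[m+1] 2∣m 2∣m+1 = prime∤1 prime[2] (∣m+n∣m⇒∣n 2∣m+1 2∣m)

¬2∣-* : ∀ {m n} → ¬ 2 ∣ m → ¬ 2 ∣ n → ¬ 2 ∣ m * n
¬2∣-* {m} {n} 2∤m 2∤n 2∣mn with euclidsLemma m n prime[2] 2∣mn
... | inj₁ 2∣m = 2∤m 2∣m
... | inj₂ 2∣n = 2∤n 2∣n

pos-^ : ∀ m e → + (m ^ e) ≡ (+ m) ℤ.^ e
pos-^ m zero    = refl
pos-^ m (suc e) = trans (pos-* m (m ^ e)) (cong (+ m ℤ.*_) (pos-^ m e))

module _ where
  open +-*-Solver

  -- Each step e ↦ e + 2 multiplies the error term by x² ≡ 1 and adds a
  -- multiple of (x + 1)²; the exponent is written j * 2 so that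
  -- 1 + suc j * 2 unfolds to 2 + (1 + j * 2).
  [x+1]²∣x^odd+1-odd*[x+1] : ∀ (x : ℤ.ℤ) j → let e = 1 + j * 2 in
    (x ℤ.+ 1ℤ) ℤ.* (x ℤ.+ 1ℤ) ℤ∣.∣ x ℤ.^ e ℤ.+ 1ℤ ℤ.- + e ℤ.* (x ℤ.+ 1ℤ)
  [x+1]²∣x^odd+1-odd*[x+1] x zero = ℤ∣.divides ℤ.0ℤ
    (solve 1 (λ x → x :* con 1ℤ :+ con 1ℤ :- con 1ℤ :* (x :+ con 1ℤ)
                    := con ℤ.0ℤ :* ((x :+ con 1ℤ) :* (x :+ con 1ℤ))) refl x)
  [x+1]²∣x^odd+1-odd*[x+1] x (suc j) =
    subst (x+1² ℤ∣.∣_) next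
      (ℤ∣.∣m∣n⇒∣m+n (ℤ∣.∣n⇒∣m*n (x ℤ.* x) ([x+1]²∣x^odd+1-odd*[x+1] x j))
                    (ℤ∣.∣m⇒∣m*n (+ e ℤ.* (x ℤ.- 1ℤ) ℤ.- 1ℤ) ℤ∣.∣-refl))
    where
    e : ℕ
    e = 1 + j * 2
    x+1 x+1² : ℤ.ℤ
    x+1 = x ℤ.+ 1ℤ
    x+1² = x+1 ℤ.* x+1
    next : x ℤ.* x ℤ.* (x ℤ.^ e ℤ.+ 1ℤ ℤ.- + e ℤ.* x+1) ℤ.+ x+1² ℤ.* (+ e ℤ.* (x ℤ.- 1ℤ) ℤ.- 1ℤ)
         ≡ x ℤ.^ suc (suc e) ℤ.+ 1ℤ ℤ.- + suc (suc e) ℤ.* x+1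
    next = begin
      x ℤ.* x ℤ.* (x ℤ.^ e ℤ.+ 1ℤ ℤ.- + e ℤ.* x+1) ℤ.+ x+1² ℤ.* (+ e ℤ.* (x ℤ.- 1ℤ) ℤ.- 1ℤ)
        ≡⟨ solve 3 (λ x y E →
             x :* x :* (y :+ con 1ℤ :- E :* (x :+ con 1ℤ))
               :+ (x :+ con 1ℤ) :* (x :+ con 1ℤ) :* (E :* (x :- con 1ℤ) :- con 1ℤ)
             := x :* (x :* y) :+ con 1ℤ :- (con (+ 2) :+ E) :* (x :+ con 1ℤ)) refl x (x ℤ.^ e) (+ e) ⟩
      x ℤ.^ suc (suc e) ℤ.+ 1ℤ ℤ.- (+ 2 ℤ.+ + e) ℤ.* x+1
        ≡⟨ cong (λ E → x ℤ.^ suc (suc e) ℤ.+ 1ℤ ℤ.- E ℤ.* x+1) (sym (pos-+ 2 e)) ⟩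
      x ℤ.^ suc (suc e) ℤ.+ 1ℤ ℤ.- + suc (suc e) ℤ.* x+1 ∎

  [n+1]²∣n^e+1 : ∀ n e → ¬ 2 ∣ e → n + 1 ∣ e → (n + 1) * (n + 1) ∣ n ^ e + 1
  [n+1]²∣n^e+1 n e 2∤e (divides k e≡k*[n+1]) =
    subst₂ _∣_ (abs-* x+1 x+1) (cong (λ m → ℤ.∣ m ℤ.+ 1ℤ ∣) (sym (pos-^ n e)))
      (ℤ∣.∣⇒∣ᵤ (subst (x+1² ℤ∣.∣_) cancel (ℤ∣.∣m∣n⇒∣m+n x+1²∣error x+1²∣k*x+1²)))
    where
    x x+1 x+1² : ℤ.ℤ
    x = + n
    x+1 = x ℤ.+ 1ℤ
    x+1² = x+1 ℤ.* x+1

    x+1²∣error : x+1² ℤ∣.∣ x ℤ.^ e ℤ.+ 1ℤ ℤ.- + e ℤ.* x+1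
    x+1²∣error = subst (λ e → x+1² ℤ∣.∣ x ℤ.^ e ℤ.+ 1ℤ ℤ.- + e ℤ.* x+1)
                       (sym (¬2∣⇒≡1+[m/2]*2 2∤e))
                       ([x+1]²∣x^odd+1-odd*[x+1] x (e / 2))

    x+1²∣k*x+1² : x+1² ℤ∣.∣ + k ℤ.* x+1²
    x+1²∣k*x+1² = ℤ∣.∣n⇒∣m*n (+ k) ℤ∣.∣-refl

    +e≡+k*x+1 : + e ≡ + k ℤ.* x+1
    +e≡+k*x+1 = trans (cong +_ e≡k*[n+1]) (pos-* k (n + 1))

    cancel : x ℤ.^ e ℤ.+ 1ℤ ℤ.- + e ℤ.* x+1 ℤ.+ + k ℤ.* x+1² ≡ x ℤ.^ e ℤ.+ 1ℤ
    cancel = begin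
      x ℤ.^ e ℤ.+ 1ℤ ℤ.- + e ℤ.* x+1 ℤ.+ + k ℤ.* x+1²
        ≡⟨ cong (λ E → x ℤ.^ e ℤ.+ 1ℤ ℤ.- E ℤ.* x+1 ℤ.+ + k ℤ.* x+1²) +e≡+k*x+1 ⟩
      x ℤ.^ e ℤ.+ 1ℤ ℤ.- + k ℤ.* x+1 ℤ.* x+1 ℤ.+ + k ℤ.* x+1²
        ≡⟨ solve 3 (λ y K X → y :+ con 1ℤ :- K :* X :* X :+ K :* (X :* X) := y :+ con 1ℤ)
                   refl (x ℤ.^ e) (+ k) x+1 ⟩
      x ℤ.^ e ℤ.+ 1ℤ ∎

prime∤radUpTo : ∀ {p} m x → Prime p → m < p → ¬ p ∣ radUpTo m x
prime∤radUpTo zero    x pp _ p∣1 = prime∤1 pp p∣1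
prime∤radUpTo (suc m) x pp 1+m<p p∣rad with prime? (suc m) ×-dec (suc m ∣? x)
... | no _ = prime∤radUpTo m x pp (<-trans (n<1+n m) 1+m<p) p∣rad
... | yes _ with euclidsLemma (suc m) (radUpTo m x) pp p∣rad
...   | inj₁ p∣1+m = <⇒≱ 1+m<p (∣⇒≤ p∣1+m)
...   | inj₂ p∣rad′ = prime∤radUpTo m x pp (<-trans (n<1+n m) 1+m<p) p∣rad′

-- The prime suc m divides y = c * radUpTo m x but not radUpTo m x, whose
-- prime factors are all at most m; so it divides c.
radUpTo∣ : ∀ m {x y} → (∀ {p} → Prime p → p ∣ x → p ∣ y) → radUpTo m x ∣ y
radUpTo∣ zero    {x} {y} primes∣ = 1∣ y
radUpTo∣ (suc m) {x} {y} primes∣ with prime? (suc m) ×-dec (suc m ∣? x)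
... | no _ = radUpTo∣ m primes∣
... | yes (pp , 1+m∣x) with radUpTo∣ m primes∣
...   | divides c y≡c*rad with euclidsLemma c (radUpTo m x) pp (subst (suc m ∣_) y≡c*rad (primes∣ pp 1+m∣x))
...     | inj₂ 1+m∣rad = ⊥-elim (prime∤radUpTo m x pp ≤-refl 1+m∣rad)
...     | inj₁ (divides d c≡d*[1+m]) = divides d (begin
          y                           ≡⟨ y≡c*rad ⟩
          c * radUpTo m x             ≡⟨ cong (_* radUpTo m x) c≡d*[1+m] ⟩
          d * suc m * radUpTo m x     ≡⟨ *-assoc d (suc m) _ ⟩
          d * (suc m * radUpTo m x)   ∎)

rad∣ : ∀ {x y} → (∀ {p} → Prime p → p ∣ x → p ∣ y) → rad x ∣ y
rad∣ {x} = radUpTo∣ x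

rad[N*[N+1]]<N+1 : ∀ {n N} → 0 < n → (∀ {p} → Prime p → p ∣ N → p ∣ n) →
  (n + 1) * (n + 1) ∣ N + 1 → rad (1 * N * (N + 1)) < N + 1
rad[N*[N+1]]<N+1 {n} {N} 0<n primes∣n (divides q N+1≡q*[n+1]²) =
  ≤-<-trans (∣⇒≤ {{y≢0}} (rad∣ primes∣y)) y<N+1
  where
  N+1≡q[n+1]*[n+1] : N + 1 ≡ q * (n + 1) * (n + 1)
  N+1≡q[n+1]*[n+1] = trans N+1≡q*[n+1]² (sym (*-assoc q (n + 1) (n + 1)))

  y : ℕ
  y = q * (n + 1) * n

  q[n+1]≢0 : NonZero (q * (n + 1))
  q[n+1]≢0 = m*n≢0⇒m≢0 (q * (n + 1))
    {{subst NonZero N+1≡q[n+1]*[n+1] (>-nonZero (m≤n+m 1 N))}}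

  y≢0 : NonZero y
  y≢0 = m*n≢0 (q * (n + 1)) n {{q[n+1]≢0}} {{>-nonZero 0<n}}

  y<N+1 : y < N + 1
  y<N+1 = subst (y <_) (sym N+1≡q[n+1]*[n+1])
            (*-monoʳ-< (q * (n + 1)) {{q[n+1]≢0}} (m<m+n n (s≤s z≤n)))

  primes∣y : ∀ {p} → Prime p → p ∣ 1 * N * (N + 1) → p ∣ y
  primes∣y {p} pp p∣1*N*[N+1] with euclidsLemma (1 * N) (N + 1) pp p∣1*N*[N+1]
  ... | inj₁ p∣1*N = ∣n⇒∣m*n (q * (n + 1)) (primes∣n pp (subst (p ∣_) (*-identityˡ N) p∣1*N))
  ... | inj₂ p∣N+1 with euclidsLemma (q * (n + 1)) (n + 1) pp (subst (p ∣_) N+1≡q[n+1]*[n+1] p∣N+1)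
  ...   | inj₁ p∣q[n+1] = ∣m⇒∣m*n n p∣q[n+1]
  ...   | inj₂ p∣n+1    = ∣m⇒∣m*n n (∣n⇒∣m*n q p∣n+1)

abcTriple[1,N,N+1] : ∀ {N} → 0 < N → rad (1 * N * (N + 1)) < N + 1 → IsAbcTriple 1 N (N + 1)
abcTriple[1,N,N+1] {N} 0<N rad<N+1 =
  ( (s≤s z≤n , 0<N , m≤n+m 1 N)
  , (1-coprimeTo N , 1-coprimeTo (N + 1) , N-coprime-N+1)
  , +-comm 1 N
  , rad<N+1 )
  where
  N-coprime-N+1 : Coprime N (N + 1)
  N-coprime-N+1 (d∣N , d∣N+1) = ∣1⇒≡1 (∣m+n∣m⇒∣n d∣N+1 d∣N)

-- The hypothesis 0 < k is implied by ¬ 2 ∣ k.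
corollary3p11 : (n k : ℕ) → 0 < n → 2 ∣ n → 0 < k → ¬ (2 ∣ k) →
    IsAbcTriple 1 (n ^ ((n + 1) * k)) (n ^ ((n + 1) * k) + 1)
corollary3p11 n k 0<n 2∣n _ 2∤k =
  abcTriple[1,N,N+1] (m^n>0 n {{>-nonZero 0<n}} e)
    (rad[N*[N+1]]<N+1 0<n (λ pp → prime∣^⇒∣ n e pp) [n+1]²∣N+1)
  where
  e : ℕ
  e = (n + 1) * k

  [n+1]²∣N+1 : (n + 1) * (n + 1) ∣ n ^ e + 1
  [n+1]²∣N+1 = [n+1]²∣n^e+1 n e
    (¬2∣-* (2∣⇒¬2∣[m+1] 2∣n) 2∤k)
    (∣m⇒∣m*n k ∣-refl)
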